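{- Let $u$ be a positive integer with $\gcd(u,6)=1$. If there exists a PPS$(\mathbb{Z}_v,A_1,A_2)$, then there exists a PPS$(\mathbb{Z}_{vu},B_1,B_2)$, where $B_i=\{a+vs : a\in A_i,\ s\in\mathbb{Z}_u\}$ for $i\in\{1,2\}$ (elements $a\in A_i$ being represented by integers in $\{0,\dots,v-1\}$ and the result read modulo $vu$).
   Context: For an abelian group $(G,+)$ and subsets $A_1,A_2\subseteq G$ with $|A_1|=|A_2|$, a partial partitionable set PPS$(G,A_1,A_2)$ is a set $\mathcal S$ of $(|G|-|A_1|)/4$ unordered pairs $\{x,y\}$ from $G$ such that $\bigcup_{\{x,y\}\in\mathcal S}\pm\{x,y\}=G\setminus A_1$ and $\bigcup_{\{x,y\}\in\mathcal S}\pm\{x-y,x+y\}=G\setminus A_2$. -}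

module Defs where

open import Data.Nat using (ℕ; zero; suc; _+_; _*_; _∸_; _<_)
open import Data.Nat.DivMod using (_mod_)
open import Data.Fin using (Fin; toℕ)
open import Data.Fin.Subset using (Subset; _∈_; _∉_; ∣_∣)
open import Data.List using (List)
open import Data.List.Relation.Unary.Any using (Any)
open import Data.List.Relation.Unary.AllPairs using (AllPairs)
open import Data.Product using (_×_; _,_; Σ)
open import Data.Sum using (_⊎_)
open import Relation.Binary.PropositionalEquality using (_≡_)
open import Relation.Nullary using (¬_)
open import Function.Bundles using (_⇔_)

infixl 6 _⊕_ _⊖_
_⊕_ : ∀ {n} → Fin n → Fin n → Fin n
_⊕_ {suc m} a b = (toℕ a + toℕ b) mod (suc m)

⊝_ : ∀ {n} → Fin n → Fin n
⊝_ {suc m} a = (suc m ∸ toℕ a) mod (suc m)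

_⊖_ : ∀ {n} → Fin n → Fin n → Fin n
a ⊖ b = a ⊕ (⊝ b)

-- An unordered pair {x,y} is represented by an ordered pair (x , y);
-- two representatives denote the same unordered pair iff equal up to swap.
SameUnordered : ∀ {n} → Fin n × Fin n → Fin n × Fin n → Set
SameUnordered (x , y) (x' , y') = (x ≡ x' × y ≡ y') ⊎ (x ≡ y' × y ≡ x')

InPM : ∀ {n} → Fin n → Fin n × Fin n → Set
InPM g (x , y) = (g ≡ x ⊎ g ≡ ⊝ x) ⊎ (g ≡ y ⊎ g ≡ ⊝ y)

InPMDiffSum : ∀ {n} → Fin n → Fin n × Fin n → Set
InPMDiffSum g (x , y) = (g ≡ x ⊖ y ⊎ g ≡ ⊝ (x ⊖ y)) ⊎ (g ≡ x ⊕ y ⊎ g ≡ ⊝ (x ⊕ y))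

-- S is a PPS(ℤ_n, A₁, A₂).
-- The count |S| = (n - |A₁|)/4 is encoded as 4·|S| + |A₁| = n.
record IsPPS (n : ℕ) (A₁ A₂ : Subset n) (S : List (Fin n × Fin n)) : Set where
  field
    sameSize : ∣ A₁ ∣ ≡ ∣ A₂ ∣
    distinct : AllPairs (λ p q → ¬ SameUnordered p q) S
    count    : 4 * Data.List.length S + ∣ A₁ ∣ ≡ n
    cover₁   : ∀ g → (g ∉ A₁) ⇔ Any (InPM g) S
    cover₂   : ∀ g → (g ∉ A₂) ⇔ Any (InPMDiffSum g) S

PPS : (n : ℕ) → Subset n → Subset n → Set
PPS n A₁ A₂ = Σ (List (Fin n × Fin n)) (IsPPS n A₁ A₂)

IsBlowUp : (v u : ℕ) → Subset v → Subset (v * u) → Set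
IsBlowUp v u A B = ∀ (g : Fin (v * u)) →
  (g ∈ B) ⇔ Σ (Fin v) (λ a → a ∈ A × Σ ℕ (λ s → s < u × (toℕ a + v * s ≡ toℕ g)))

-- Each pair {x, y} of the given PPS(ℤ_v, A₁, A₂) is replaced by the u pairs
-- {x + vs, y + 2vs}, s < u.  Reduction modulo v is a homomorphism ℤ_vu → ℤ_v
-- sending these pairs to {x, y}, and as s runs through ℤ_u the lifts x + vs,
-- y + 2vs, (x + vs) − (y + 2vs) = x − y − vs and (x + vs) + (y + 2vs) = x + y + 3vs
-- each run through the whole fibre over their reduction, because 1, 2, −1 and 3 are
-- units modulo u.  Hence the new pairs cover exactly the fibres over ℤ_v ∖ Aᵢ, which
-- make up ℤ_vu ∖ Bᵢ.  Lifted pairs are pairwise distinct: over distinct pairs this is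
-- seen after reduction, and within one fibre a swapped coincidence forces 3s ≡ 0.

module Submission where

open import Defs
open import Data.Bool using (true; false)
open import Data.Fin as Fin using (Fin; toℕ; fromℕ<; reduce≥)
open import Data.Fin.Properties using (toℕ-injective; toℕ-fromℕ<; toℕ<n; toℕ-cast)
open import Data.Fin.Subset using (Subset; _∈_; _∉_; ∣_∣)
open import Data.List using (List; []; _∷_; length; applyUpTo; concatMap)
import Data.List as List
open import Data.List.Properties using (length-++; length-applyUpTo)
import Data.List.Relation.Unary.All as All
import Data.List.Relation.Unary.All.Properties as All
open import Data.List.Relation.Unary.AllPairs using (AllPairs)
import Data.List.Relation.Unary.AllPairs as AllPairs
import Data.List.Relation.Unary.AllPairs.Properties as AllPairs
open import Data.List.Relation.Unary.Any using (Any)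
import Data.List.Relation.Unary.Any as Any
import Data.List.Relation.Unary.Any.Properties as Any
open import Data.Nat
open import Data.Nat.Coprimality using (Coprime; coprime-Bézout)
open import Data.Nat.DivMod
open import Data.Nat.Divisibility using (_∣_; divides; ∣-trans)
open import Data.Nat.GCD using (module Bézout)
open import Data.Nat.Properties
open import Algebra.Properties.CommutativeSemigroup +-commutativeSemigroup using (x∙yz≈y∙xz)
open import Data.Nat.Tactic.RingSolver using (solve-∀)
open import Data.Product using (∃-syntax; _×_; _,_)
import Data.Product as Product
open import Data.Sum as Sum using (_⊎_; inj₁; inj₂)
open import Data.Sum.Function.Propositional using (_⊎-⇔_)
open import Data.Vec using (Vec; _++_; []; _∷_; lookup; cast)
import Data.Vec.Properties as Vec
open import Function using (_∘_)
open import Function.Bundles using (_⇔_; mk⇔; Equivalence)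
import Function.Properties.Equivalence as ⇔
open import Function.Related.TypeIsomorphisms using (¬-cong-⇔)
open import Level using (0ℓ)
open import Relation.Binary.Bundles using (Setoid)
import Relation.Binary.Reasoning.Setoid
open import Relation.Binary.PropositionalEquality
open import Relation.Nullary using (¬_; yes; no)

infix 4 _≈[_]_
record _≈[_]_ (a n : ℕ) .{{_ : NonZero n}} (b : ℕ) : Set where
  constructor mod-eq
  field %-eq : a % n ≡ b % n

module _ {n : ℕ} .{{_ : NonZero n}} where

  ≈-refl : ∀ {a} → a ≈[ n ] a
  ≈-refl = mod-eq refl

  ≈-sym : ∀ {a b} → a ≈[ n ] b → b ≈[ n ] a
  ≈-sym (mod-eq e) = mod-eq (sym e)

  ≈-trans : ∀ {a b c} → a ≈[ n ] b → b ≈[ n ] c → a ≈[ n ] c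
  ≈-trans (mod-eq e) (mod-eq f) = mod-eq (trans e f)

  ≈-setoid : Setoid 0ℓ 0ℓ
  ≈-setoid = record
    { Carrier = ℕ
    ; _≈_ = λ a b → a ≈[ n ] b
    ; isEquivalence = record { refl = ≈-refl ; sym = ≈-sym ; trans = ≈-trans }
    }

  module ≈-Reasoning = Relation.Binary.Reasoning.Setoid ≈-setoid

  ≡⇒≈ : ∀ {a b} → a ≡ b → a ≈[ n ] b
  ≡⇒≈ refl = ≈-refl

  +-cong-≈ : ∀ {a b c d} → a ≈[ n ] b → c ≈[ n ] d → a + c ≈[ n ] b + d
  +-cong-≈ {a} {b} {c} {d} (mod-eq e) (mod-eq f) = mod-eq (begin
    (a + c) % n           ≡⟨ %-distribˡ-+ a c n ⟩
    (a % n + c % n) % n   ≡⟨ cong₂ (λ x y → (x + y) % n) e f ⟩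
    (b % n + d % n) % n   ≡⟨ %-distribˡ-+ b d n ⟨
    (b + d) % n           ∎)
    where open ≡-Reasoning

  *-cong-≈ : ∀ {a b c d} → a ≈[ n ] b → c ≈[ n ] d → a * c ≈[ n ] b * d
  *-cong-≈ {a} {b} {c} {d} (mod-eq e) (mod-eq f) = mod-eq (begin
    (a * c) % n           ≡⟨ %-distribˡ-* a c n ⟩
    (a % n * (c % n)) % n ≡⟨ cong₂ (λ x y → (x * y) % n) e f ⟩
    (b % n * (d % n)) % n ≡⟨ %-distribˡ-* b d n ⟨
    (b * d) % n           ∎)
    where open ≡-Reasoning

  %-≈ : ∀ a → a % n ≈[ n ] a
  %-≈ a = mod-eq (m%n%n≡m%n a n)

  +-*-≈ : ∀ a k → a + k * n ≈[ n ] a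
  +-*-≈ a k = mod-eq ([m+kn]%n≡m%n a k n)

  n≈0 : n ≈[ n ] 0
  n≈0 = ≈-trans (≡⇒≈ (sym (+-identityʳ n))) (+-*-≈ 0 1)

  +-inverse-≈ : ∀ a → a + (n ∸ a % n) ≈[ n ] 0
  +-inverse-≈ a = begin
    a + (n ∸ a % n)      ≈⟨ +-cong-≈ (%-≈ a) ≈-refl ⟨
    a % n + (n ∸ a % n)  ≡⟨ m+[n∸m]≡n (<⇒≤ (m%n<n a n)) ⟩
    n                    ≈⟨ n≈0 ⟩
    0                    ∎
    where open ≈-Reasoning

  +-inverse-cancelˡ-≈ : ∀ a b → a + (b + (n ∸ a % n)) ≈[ n ] b
  +-inverse-cancelˡ-≈ a b = begin
    a + (b + (n ∸ a % n))   ≡⟨ x∙yz≈y∙xz a b _ ⟩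
    b + (a + (n ∸ a % n))   ≈⟨ +-cong-≈ (≈-refl {b}) (+-inverse-≈ a) ⟩
    b + 0                   ≡⟨ +-identityʳ b ⟩
    b                       ∎
    where open ≈-Reasoning

  +-cancelʳ-≈ : ∀ {a b} c → a + c ≈[ n ] b + c → a ≈[ n ] b
  +-cancelʳ-≈ {a} {b} c e = begin
    a                ≡⟨ +-identityʳ a ⟨
    a + 0            ≈⟨ +-cong-≈ (≈-refl {a}) (+-inverse-≈ c) ⟨
    a + (c + c⁻)     ≡⟨ +-assoc a c c⁻ ⟨
    a + c + c⁻       ≈⟨ +-cong-≈ e ≈-refl ⟩
    b + c + c⁻       ≡⟨ +-assoc b c c⁻ ⟩
    b + (c + c⁻)     ≈⟨ +-cong-≈ (≈-refl {b}) (+-inverse-≈ c) ⟩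
    b + 0            ≡⟨ +-identityʳ b ⟩
    b                ∎
    where
    open ≈-Reasoning
    c⁻ = n ∸ c % n

  ≈⇒≡ : ∀ {a b} → a < n → b < n → a ≈[ n ] b → a ≡ b
  ≈⇒≡ a<n b<n (mod-eq e) = trans (sym (m<n⇒m%n≡m a<n)) (trans e (m<n⇒m%n≡m b<n))

  +-transpose-≈ : ∀ {a b y z} → y + z ≈[ n ] 0 → (a ≈[ n ] b + z ⇔ a + y ≈[ n ] b)
  +-transpose-≈ {a} {b} {y} {z} y+z≈0 = mk⇔ to from
    where
    open ≈-Reasoning
    to : a ≈[ n ] b + z → a + y ≈[ n ] b
    to e = begin
      a + y          ≈⟨ +-cong-≈ e ≈-refl ⟩
      b + z + y      ≡⟨ +-assoc b z y ⟩
      b + (z + y)    ≡⟨ cong (b +_) (+-comm z y) ⟩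
      b + (y + z)    ≈⟨ +-cong-≈ (≈-refl {b}) y+z≈0 ⟩
      b + 0          ≡⟨ +-identityʳ b ⟩
      b              ∎
    from : a + y ≈[ n ] b → a ≈[ n ] b + z
    from e = begin
      a              ≡⟨ +-identityʳ a ⟨
      a + 0          ≈⟨ +-cong-≈ (≈-refl {a}) y+z≈0 ⟨
      a + (y + z)    ≡⟨ +-assoc a y z ⟨
      a + y + z      ≈⟨ +-cong-≈ e ≈-refl ⟩
      b + z          ∎

≈-divisor : ∀ {m n a b} .{{_ : NonZero m}} .{{_ : NonZero n}} →
            m ∣ n → a ≈[ n ] b → a ≈[ m ] b
≈-divisor {m} {n} {a} {b} m∣n (mod-eq e) = mod-eq (begin
  a % m        ≡⟨ m∣n⇒o%n%m≡o%m m n a m∣n ⟨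
  a % n % m    ≡⟨ cong (_% m) e ⟩
  b % n % m    ≡⟨ m∣n⇒o%n%m≡o%m m n b m∣n ⟩
  b % m        ∎)
  where open ≡-Reasoning

coprime-∣ʳ : ∀ {c m n} → Coprime m n → c ∣ n → Coprime c m
coprime-∣ʳ coprime c∣n (i∣c , i∣m) = coprime (i∣m , ∣-trans i∣c c∣n)

Invertible : (n : ℕ) .{{_ : NonZero n}} → ℕ → Set
Invertible n c = ∃[ d ] c * d ≈[ n ] 1

invertible-*-≈0 : ∀ {n c s} .{{_ : NonZero n}} → Invertible n c → c * s ≈[ n ] 0 → s ≈[ n ] 0
invertible-*-≈0 {n} {c} {s} (d , cd≈1) cs≈0 = begin
  s              ≡⟨ *-identityˡ s ⟨
  1 * s          ≈⟨ *-cong-≈ cd≈1 (≈-refl {a = s}) ⟨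
  c * d * s      ≡⟨ regroup c d s ⟩
  d * (c * s)    ≈⟨ *-cong-≈ (≈-refl {a = d}) cs≈0 ⟩
  d * 0          ≡⟨ *-zeroʳ d ⟩
  0              ∎
  where
  open ≈-Reasoning {n}
  regroup : ∀ c d s → c * d * s ≡ d * (c * s)
  regroup = solve-∀

-- In the second Bézout form x c ≡ −1, and m ≡ −1 modulo 1 + m, so x m inverts c.
coprime⇒invertible : ∀ {c m} → Coprime c (suc m) → Invertible (suc m) c
coprime⇒invertible {c} {m} cop with coprime-Bézout cop
... | Bézout.+- x y eq = x , ≈-trans (≡⇒≈ (trans (*-comm c x) (sym eq))) (+-*-≈ 1 y)
... | Bézout.-+ x y eq = x * m , +-cancelʳ-≈ m (begin
  c * (x * m) + m    ≡⟨ regroup c x m ⟩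
  (1 + x * c) * m    ≈⟨ *-cong-≈ (≈-trans (≡⇒≈ eq) (+-*-≈ 0 y)) (≈-refl {a = m}) ⟩
  0                  ≈⟨ n≈0 ⟨
  1 + m              ∎)
  where
  open ≈-Reasoning {suc m}
  regroup : ∀ c x m → c * (x * m) + m ≡ (1 + x * c) * m
  regroup = solve-∀

module _ {m : ℕ} where
  private n = suc m

  toℕ-mod : ∀ a → toℕ (a mod n) ≈[ n ] a
  toℕ-mod a = ≈-trans (≡⇒≈ (toℕ-fromℕ< (m%n<n a n))) (%-≈ a)

  toℕ-⊕ : ∀ (a b : Fin n) → toℕ (a ⊕ b) ≈[ n ] toℕ a + toℕ b
  toℕ-⊕ a b = toℕ-mod (toℕ a + toℕ b)

  toℕ-⊝ : ∀ (a : Fin n) → toℕ (⊝ a) + toℕ a ≈[ n ] 0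
  toℕ-⊝ a = ≈-trans (+-cong-≈ (toℕ-mod (n ∸ toℕ a)) ≈-refl)
                    (≈-trans (≡⇒≈ (m∸n+n≡m (<⇒≤ (toℕ<n a)))) n≈0)

  toℕ-≈-injective : ∀ {a b : Fin n} → toℕ a ≈[ n ] toℕ b → a ≡ b
  toℕ-≈-injective {a} {b} = toℕ-injective ∘ ≈⇒≡ (toℕ<n a) (toℕ<n b)

  mod-≈ : ∀ {a b} → a ≈[ n ] b → a mod n ≡ b mod n
  mod-≈ {a} {b} e = toℕ-≈-injective (≈-trans (toℕ-mod a) (≈-trans e (≈-sym (toℕ-mod b))))

  ≡⇔≈ : ∀ {g p : Fin n} {G P} → toℕ g ≈[ n ] G → toℕ p ≈[ n ] P → g ≡ p ⇔ G ≈[ n ] P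
  ≡⇔≈ g≈G p≈P = mk⇔ (λ { refl → ≈-trans (≈-sym g≈G) p≈P })
                    (λ e → toℕ-≈-injective (≈-trans g≈G (≈-trans e (≈-sym p≈P))))

  ≡⊝⇔+≈0 : ∀ {g p : Fin n} {G P} → toℕ g ≈[ n ] G → toℕ p ≈[ n ] P → g ≡ ⊝ p ⇔ G + P ≈[ n ] 0
  ≡⊝⇔+≈0 {p = p} {P = P} g≈G p≈P = ⇔.trans (≡⇔≈ g≈G ≈-refl) (+-transpose-≈ P+⊝p≈0)
    where
    P+⊝p≈0 : P + toℕ (⊝ p) ≈[ n ] 0
    P+⊝p≈0 = ≈-trans (≡⇒≈ (+-comm P _)) (≈-trans (+-cong-≈ ≈-refl (≈-sym p≈P)) (toℕ-⊝ p))

∣p++q∣ : ∀ {m n} (p : Subset m) (q : Subset n) → ∣ p ++ q ∣ ≡ ∣ p ∣ + ∣ q ∣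
∣p++q∣ []          q = refl
∣p++q∣ (true ∷ p)  q = cong suc (∣p++q∣ p q)
∣p++q∣ (false ∷ p) q = ∣p++q∣ p q

∣cast∣ : ∀ {m n} (eq : m ≡ n) (p : Subset m) → ∣ cast eq p ∣ ≡ ∣ p ∣
∣cast∣ refl p = cong ∣_∣ (Vec.cast-is-id refl p)

∈⇔∈⇒lookup≡ : ∀ {m n} {p : Subset m} {q : Subset n} {i j} → (i ∈ p ⇔ j ∈ q) → lookup p i ≡ lookup q j
∈⇔∈⇒lookup≡ {p = p} {q} {i} {j} i∈p⇔j∈q with lookup p i in e₁ | lookup q j in e₂
... | true  | true  = refl
... | false | false = refl
... | true  | false = trans (sym (Vec.[]=⇒lookup (Equivalence.to i∈p⇔j∈q (Vec.lookup⇒[]= i p e₁)))) e₂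
... | false | true  = trans (sym e₁) (Vec.[]=⇒lookup (Equivalence.from i∈p⇔j∈q (Vec.lookup⇒[]= j q e₂)))

lookup-ext : ∀ {a} {A : Set a} {n} {p q : Vec A n} → (∀ i → lookup p i ≡ lookup q i) → p ≡ q
lookup-ext {p = p} {q} h =
  trans (sym (Vec.tabulate∘lookup p)) (trans (Vec.tabulate-cong h) (Vec.tabulate∘lookup q))

toℕ-reduce≥ : ∀ {m n} (i : Fin (m + n)) .(m≤i : m ≤ toℕ i) → toℕ (reduce≥ i m≤i) + m ≡ toℕ i
toℕ-reduce≥ {zero}  i       _   = +-identityʳ (toℕ i)
toℕ-reduce≥ {suc m} (Fin.suc i) m≤i = trans (+-suc _ m) (cong suc (toℕ-reduce≥ {m} i (s≤s⁻¹ m≤i)))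

module _ {w′ : ℕ} (A : Subset (suc w′)) where
  private w = suc w′

  repeat : ∀ k → Subset (k * w)
  repeat zero    = []
  repeat (suc k) = A ++ repeat k

  ∣repeat∣ : ∀ k → ∣ repeat k ∣ ≡ k * ∣ A ∣
  ∣repeat∣ zero    = refl
  ∣repeat∣ (suc k) = trans (∣p++q∣ A (repeat k)) (cong (∣ A ∣ +_) (∣repeat∣ k))

  lookup-repeat : ∀ k i → lookup (repeat k) i ≡ lookup A (toℕ i mod w)
  lookup-repeat (suc k) i with toℕ i <? w
  ... | yes i<w = trans (Vec.lookup-++-< A (repeat k) i i<w) (cong (lookup A) fromℕ<i≡i-mod-w)
    where
    fromℕ<i≡i-mod-w : fromℕ< i<w ≡ toℕ i mod w
    fromℕ<i≡i-mod-w = toℕ-≈-injective (≈-trans (≡⇒≈ (toℕ-fromℕ< i<w)) (≈-sym (toℕ-mod (toℕ i))))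
  ... | no i≮w = trans (Vec.lookup-++-≥ A (repeat k) i w≤i)
                       (trans (lookup-repeat k r) (cong (lookup A) (mod-≈ r≈i)))
    where
    w≤i = ≮⇒≥ i≮w
    r = reduce≥ i w≤i
    r≈i : toℕ r ≈[ w ] toℕ i
    r≈i = ≈-trans (≈-sym (mod-eq ([m+n]%n≡m%n (toℕ r) w))) (≡⇒≈ (toℕ-reduce≥ i w≤i))

-- InPM and InPMDiffSum read on representatives in ℕ; g ≡ ⊝ x is written g + x ≈ 0 and
-- g ≡ x ⊖ y as g + y ≈ x, so that no subtraction occurs.
InPMᴺ : (n : ℕ) .{{_ : NonZero n}} → ℕ → ℕ → ℕ → Set
InPMᴺ n G X Y = (G ≈[ n ] X ⊎ G + X ≈[ n ] 0) ⊎ (G ≈[ n ] Y ⊎ G + Y ≈[ n ] 0)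

InPMDiffSumᴺ : (n : ℕ) .{{_ : NonZero n}} → ℕ → ℕ → ℕ → Set
InPMDiffSumᴺ n G X Y = (G + Y ≈[ n ] X ⊎ G + X ≈[ n ] Y) ⊎ (G ≈[ n ] X + Y ⊎ G + (X + Y) ≈[ n ] 0)

module _ {m : ℕ} {g x y : Fin (suc m)} {G X Y : ℕ}
         (g≈G : toℕ g ≈[ suc m ] G) (x≈X : toℕ x ≈[ suc m ] X) (y≈Y : toℕ y ≈[ suc m ] Y) where
  private n = suc m

  InPM⇔InPMᴺ : InPM g (x , y) ⇔ InPMᴺ n G X Y
  InPM⇔InPMᴺ = (≡⇔≈ g≈G x≈X ⊎-⇔ ≡⊝⇔+≈0 g≈G x≈X) ⊎-⇔ (≡⇔≈ g≈G y≈Y ⊎-⇔ ≡⊝⇔+≈0 g≈G y≈Y)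

  InPMDiffSum⇔InPMDiffSumᴺ : InPMDiffSum g (x , y) ⇔ InPMDiffSumᴺ n G X Y
  InPMDiffSum⇔InPMDiffSumᴺ =
    (⇔.trans (≡⇔≈ g≈G x⊖y≈) (+-transpose-≈ Y+Z≈0) ⊎-⇔
     ⇔.trans (≡⊝⇔+≈0 g≈G x⊖y≈) (⇔.trans reassoc (⇔.sym (+-transpose-≈ Z+Y≈0))))
    ⊎-⇔
    (≡⇔≈ g≈G x⊕y≈ ⊎-⇔ ≡⊝⇔+≈0 g≈G x⊕y≈)
    where
    Z = toℕ (⊝ y)
    Z+Y≈0 : Z + Y ≈[ n ] 0
    Z+Y≈0 = ≈-trans (+-cong-≈ ≈-refl (≈-sym y≈Y)) (toℕ-⊝ y)
    Y+Z≈0 : Y + Z ≈[ n ] 0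
    Y+Z≈0 = ≈-trans (≡⇒≈ (+-comm Y Z)) Z+Y≈0
    x⊖y≈ : toℕ (x ⊖ y) ≈[ n ] X + Z
    x⊖y≈ = ≈-trans (toℕ-⊕ x (⊝ y)) (+-cong-≈ x≈X ≈-refl)
    x⊕y≈ : toℕ (x ⊕ y) ≈[ n ] X + Y
    x⊕y≈ = ≈-trans (toℕ-⊕ x y) (+-cong-≈ x≈X y≈Y)
    reassoc : G + (X + Z) ≈[ n ] 0 ⇔ G + X + Z ≈[ n ] 0
    reassoc = mk⇔ (≈-trans (≡⇒≈ (+-assoc G X Z))) (≈-trans (≡⇒≈ (sym (+-assoc G X Z))))

module BlowUp (v′ u′ : ℕ) where

  v u N : ℕ
  v = suc v′
  u = suc u′
  N = v * u

  π : Fin N → Fin v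
  π g = toℕ g mod v

  lift : Fin v → ℕ → Fin N
  lift x s = (toℕ x + v * s) mod N

  ≈N⇒≈v : ∀ {a b} → a ≈[ N ] b → a ≈[ v ] b
  ≈N⇒≈v = ≈-divisor (divides u (*-comm v u))

  +v*-≈ : ∀ a s → a + v * s ≈[ v ] a
  +v*-≈ a s = ≈-trans (≡⇒≈ (cong (a +_) (*-comm v s))) (+-*-≈ a s)

  toℕ-π : ∀ g → toℕ (π g) ≈[ v ] toℕ g
  toℕ-π g = toℕ-mod (toℕ g)

  toℕ-lift : ∀ x s → toℕ (lift x s) ≈[ N ] toℕ x + v * s
  toℕ-lift x s = toℕ-mod (toℕ x + v * s)

  π-lift : ∀ x s → π (lift x s) ≡ x
  π-lift x s = toℕ-≈-injective
    (≈-trans (toℕ-π (lift x s)) (≈-trans (≈N⇒≈v (toℕ-lift x s)) (+v*-≈ (toℕ x) s)))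

  v*-≈⇔ : ∀ {a b} → a ≈[ u ] b ⇔ v * a ≈[ N ] v * b
  v*-≈⇔ {a} {b} = mk⇔
    (λ (mod-eq e) → mod-eq (trans (sym (scaled a)) (trans (cong (_* v) e) (scaled b))))
    (λ (mod-eq e) → mod-eq (*-cancelʳ-≡ (a % u) (b % u) v (trans (scaled a) (trans e (sym (scaled b))))))
    where
    scaled : ∀ a → a % u * v ≡ v * a % N
    scaled a = trans (m%n*o≡m*o%[n*o] a u v)
                     (trans (cong (_% (u * v)) (*-comm a v)) (%-congʳ {o = v * a} (*-comm u v)))

  -- Writing a = r + q_a v and b = r + q_b v, the step s ≡ q_b - q_a (mod u) works.
  solve₁ : ∀ {a b} → a ≈[ v ] b → ∃[ s ] s < u × a + v * s ≈[ N ] b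
  solve₁ {a} {b} (mod-eq a%v≡b%v) = s , m%n<n (b / v + (u ∸ a / v % u)) u , (begin
    a + v * s                     ≡⟨ cong (_+ v * s) (m≡m%n+[m/n]*n a v) ⟩
    a % v + a / v * v + v * s     ≡⟨ regroup (a % v) (a / v) v s ⟩
    a % v + v * (a / v + s)       ≈⟨ +-cong-≈ (≈-refl {a = a % v}) (Equivalence.to v*-≈⇔ quotients) ⟩
    a % v + v * (b / v)           ≡⟨ cong₂ _+_ a%v≡b%v (*-comm v (b / v)) ⟩
    b % v + b / v * v             ≡⟨ m≡m%n+[m/n]*n b v ⟨
    b                             ∎)
    where
    open ≈-Reasoning {N}
    s = (b / v + (u ∸ a / v % u)) % u
    regroup : ∀ r q v s → r + q * v + v * s ≡ r + v * (q + s)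
    regroup = solve-∀
    quotients : a / v + s ≈[ u ] b / v
    quotients = ≈-trans (+-cong-≈ (≈-refl {a = a / v}) (%-≈ (b / v + (u ∸ a / v % u))))
                        (+-inverse-cancelˡ-≈ (a / v) (b / v))

  solve : ∀ {a b} c → Invertible u c → a ≈[ v ] b → ∃[ s ] s < u × a + v * (c * s) ≈[ N ] b
  solve {a} {b} c (d , cd≈1) a≈b with solve₁ a≈b
  ... | t , _ , a+vt≈b = (d * t) % u , m%n<n (d * t) u ,
        ≈-trans (+-cong-≈ (≈-refl {a = a}) (Equivalence.to v*-≈⇔ cs≈t)) a+vt≈b
    where
    open ≈-Reasoning {u}
    cs≈t : c * ((d * t) % u) ≈[ u ] t
    cs≈t = begin
      c * ((d * t) % u)  ≈⟨ *-cong-≈ (≈-refl {a = c}) (%-≈ (d * t)) ⟩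
      c * (d * t)        ≡⟨ *-assoc c d t ⟨
      c * d * t          ≈⟨ *-cong-≈ cd≈1 (≈-refl {a = t}) ⟩
      1 * t              ≡⟨ *-identityˡ t ⟩
      t                  ∎

  InPMᴺ-lift : ∀ {G X Y} → Invertible u 2 → InPMᴺ v G X Y →
               ∃[ s ] s < u × InPMᴺ N G (X + v * s) (Y + v * (2 * s))
  InPMᴺ-lift _ (inj₁ (inj₁ G≈X)) with solve₁ (≈-sym G≈X)
  ... | s , s<u , e = s , s<u , inj₁ (inj₁ (≈-sym e))
  InPMᴺ-lift {G} {X} _ (inj₁ (inj₂ G+X≈0)) with solve₁ G+X≈0
  ... | s , s<u , e = s , s<u , inj₁ (inj₂ (≈-trans (≡⇒≈ (sym (+-assoc G X (v * s)))) e))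
  InPMᴺ-lift inv₂ (inj₂ (inj₁ G≈Y)) with solve 2 inv₂ (≈-sym G≈Y)
  ... | s , s<u , e = s , s<u , inj₂ (inj₁ (≈-sym e))
  InPMᴺ-lift {G} {Y = Y} inv₂ (inj₂ (inj₂ G+Y≈0)) with solve 2 inv₂ G+Y≈0
  ... | s , s<u , e = s , s<u , inj₂ (inj₂ (≈-trans (≡⇒≈ (sym (+-assoc G Y (v * (2 * s))))) e))

  InPMDiffSumᴺ-lift : ∀ {G X Y} → Invertible u 3 → InPMDiffSumᴺ v G X Y →
                      ∃[ s ] s < u × InPMDiffSumᴺ N G (X + v * s) (Y + v * (2 * s))
  InPMDiffSumᴺ-lift {G} {X} {Y} _ (inj₁ (inj₁ G+Y≈X)) with solve₁ G+Y≈X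
  ... | s , s<u , e = s , s<u , inj₁ (inj₁ (≈-trans (≡⇒≈ (regroup G Y v s)) (+-cong-≈ e ≈-refl)))
    where
    regroup : ∀ G Y v s → G + (Y + v * (2 * s)) ≡ G + Y + v * s + v * s
    regroup = solve-∀
  InPMDiffSumᴺ-lift {G} {X} {Y} _ (inj₁ (inj₂ G+X≈Y)) with solve₁ (≈-sym G+X≈Y)
  ... | s , s<u , e = s , s<u , inj₁ (inj₂
        (≈-trans (≡⇒≈ (sym (+-assoc G X (v * s))))
                 (≈-trans (+-cong-≈ (≈-sym e) ≈-refl) (≡⇒≈ (regroup Y v s)))))
    where
    regroup : ∀ Y v s → Y + v * s + v * s ≡ Y + v * (2 * s)
    regroup = solve-∀
  InPMDiffSumᴺ-lift {G} {X} {Y} inv₃ (inj₂ (inj₁ G≈X+Y)) with solve 3 inv₃ (≈-sym G≈X+Y)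
  ... | s , s<u , e = s , s<u , inj₂ (inj₁ (≈-trans (≈-sym e) (≡⇒≈ (regroup X Y v s))))
    where
    regroup : ∀ X Y v s → X + Y + v * (3 * s) ≡ X + v * s + (Y + v * (2 * s))
    regroup = solve-∀
  InPMDiffSumᴺ-lift {G} {X} {Y} inv₃ (inj₂ (inj₂ G+[X+Y]≈0)) with solve 3 inv₃ G+[X+Y]≈0
  ... | s , s<u , e = s , s<u , inj₂ (inj₂ (≈-trans (≡⇒≈ (regroup G X Y v s)) e))
    where
    regroup : ∀ G X Y v s → G + (X + v * s + (Y + v * (2 * s))) ≡ G + (X + Y) + v * (3 * s)
    regroup = solve-∀

  InPMᴺ-reduce : ∀ {G X Y} → InPMᴺ N G X Y → InPMᴺ v G X Y
  InPMᴺ-reduce = Sum.map (Sum.map ≈N⇒≈v ≈N⇒≈v) (Sum.map ≈N⇒≈v ≈N⇒≈v)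

  InPMDiffSumᴺ-reduce : ∀ {G X Y} → InPMDiffSumᴺ N G X Y → InPMDiffSumᴺ v G X Y
  InPMDiffSumᴺ-reduce = Sum.map (Sum.map ≈N⇒≈v ≈N⇒≈v) (Sum.map ≈N⇒≈v ≈N⇒≈v)

  liftedPair : Fin v × Fin v → ℕ → Fin N × Fin N
  liftedPair (x , y) s = lift x s , lift y (2 * s)

  module _ (g : Fin N) (x y : Fin v) where

    InPM-liftedPair⇔ : ∀ s → InPM g (liftedPair (x , y) s) ⇔
                             InPMᴺ N (toℕ g) (toℕ x + v * s) (toℕ y + v * (2 * s))
    InPM-liftedPair⇔ s = InPM⇔InPMᴺ ≈-refl (toℕ-lift x s) (toℕ-lift y (2 * s))

    InPMDiffSum-liftedPair⇔ : ∀ s → InPMDiffSum g (liftedPair (x , y) s) ⇔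
                                    InPMDiffSumᴺ N (toℕ g) (toℕ x + v * s) (toℕ y + v * (2 * s))
    InPMDiffSum-liftedPair⇔ s = InPMDiffSum⇔InPMDiffSumᴺ ≈-refl (toℕ-lift x s) (toℕ-lift y (2 * s))

    InPM-π⇔ : ∀ s → InPM (π g) (x , y) ⇔ InPMᴺ v (toℕ g) (toℕ x + v * s) (toℕ y + v * (2 * s))
    InPM-π⇔ s = InPM⇔InPMᴺ (toℕ-π g) (≈-sym (+v*-≈ (toℕ x) s)) (≈-sym (+v*-≈ (toℕ y) (2 * s)))

    InPMDiffSum-π⇔ : ∀ s → InPMDiffSum (π g) (x , y) ⇔
                           InPMDiffSumᴺ v (toℕ g) (toℕ x + v * s) (toℕ y + v * (2 * s))
    InPMDiffSum-π⇔ s =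
      InPMDiffSum⇔InPMDiffSumᴺ (toℕ-π g) (≈-sym (+v*-≈ (toℕ x) s)) (≈-sym (+v*-≈ (toℕ y) (2 * s)))

  InPM-reduce : ∀ g p s → InPM g (liftedPair p s) → InPM (π g) p
  InPM-reduce g (x , y) s =
    Equivalence.from (InPM-π⇔ g x y s) ∘ InPMᴺ-reduce ∘ Equivalence.to (InPM-liftedPair⇔ g x y s)

  InPMDiffSum-reduce : ∀ g p s → InPMDiffSum g (liftedPair p s) → InPMDiffSum (π g) p
  InPMDiffSum-reduce g (x , y) s =
    Equivalence.from (InPMDiffSum-π⇔ g x y s) ∘ InPMDiffSumᴺ-reduce
    ∘ Equivalence.to (InPMDiffSum-liftedPair⇔ g x y s)

  InPM-lift : Invertible u 2 → ∀ g p → InPM (π g) p → ∃[ s ] s < u × InPM g (liftedPair p s)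
  InPM-lift inv₂ g (x , y) h
    with InPMᴺ-lift inv₂ (Equivalence.to (InPM⇔InPMᴺ {x = x} {y = y} (toℕ-π g) ≈-refl ≈-refl) h)
  ... | s , s<u , h′ = s , s<u , Equivalence.from (InPM-liftedPair⇔ g x y s) h′

  InPMDiffSum-lift : Invertible u 3 → ∀ g p → InPMDiffSum (π g) p →
                     ∃[ s ] s < u × InPMDiffSum g (liftedPair p s)
  InPMDiffSum-lift inv₃ g (x , y) h
    with InPMDiffSumᴺ-lift inv₃
           (Equivalence.to (InPMDiffSum⇔InPMDiffSumᴺ {x = x} {y = y} (toℕ-π g) ≈-refl ≈-refl) h)
  ... | s , s<u , h′ = s , s<u , Equivalence.from (InPMDiffSum-liftedPair⇔ g x y s) h′

  fibre : Fin v × Fin v → List (Fin N × Fin N)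
  fibre p = applyUpTo (liftedPair p) u

  liftPairs : List (Fin v × Fin v) → List (Fin N × Fin N)
  liftPairs = concatMap fibre

  length-liftPairs : ∀ S → length (liftPairs S) ≡ length S * u
  length-liftPairs []      = refl
  length-liftPairs (p ∷ S) =
    trans (length-++ (fibre p)) (cong₂ _+_ (length-applyUpTo (liftedPair p) u) (length-liftPairs S))

  module _ (R : ∀ {n} → Fin n → Fin n × Fin n → Set)
           (reduce : ∀ g p s → R g (liftedPair p s) → R (π g) p)
           (lift : ∀ g p → R (π g) p → ∃[ s ] s < u × R g (liftedPair p s)) where

    Any-liftPairs⇔ : ∀ g S → Any (R (π g)) S ⇔ Any (R g) (liftPairs S)
    Any-liftPairs⇔ g S = mk⇔ (Any.concat⁺ ∘ Any.map⁺ ∘ Any.map into-fibre)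
                             (Any.map from-fibre ∘ Any.map⁻ ∘ Any.concat⁻ (List.map fibre S))
      where
      into-fibre : ∀ {p} → R (π g) p → Any (R g) (fibre p)
      into-fibre {p} h = let s , s<u , h′ = lift g p h in Any.applyUpTo⁺ (liftedPair p) h′ s<u
      from-fibre : ∀ {p} → Any (R g) (fibre p) → R (π g) p
      from-fibre {p} h = let s , _ , h′ = Any.applyUpTo⁻ (liftedPair p) h in reduce g p s h′

    cover-liftPairs : ∀ {A : Subset v} {B : Subset N} {S} →
                      (∀ h → h ∉ A ⇔ Any (R h) S) → (∀ g → g ∈ B ⇔ π g ∈ A) →
                      ∀ g → g ∉ B ⇔ Any (R g) (liftPairs S)
    cover-liftPairs {S = S} cover-A ∈B⇔ g =
      ⇔.trans (¬-cong-⇔ (∈B⇔ g)) (⇔.trans (cover-A (π g)) (Any-liftPairs⇔ g S))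

  lift-injective : ∀ x {a b} → lift x a ≡ lift x b → a ≈[ u ] b
  lift-injective x {a} {b} e = Equivalence.from v*-≈⇔ (+-cancelʳ-≈ (toℕ x) (begin
    v * a + toℕ x    ≡⟨ +-comm (v * a) (toℕ x) ⟩
    toℕ x + v * a    ≈⟨ toℕ-lift x a ⟨
    toℕ (lift x a)   ≡⟨ cong toℕ e ⟩
    toℕ (lift x b)   ≈⟨ toℕ-lift x b ⟩
    toℕ x + v * b    ≡⟨ +-comm (toℕ x) (v * b) ⟩
    v * b + toℕ x    ∎))
    where open ≈-Reasoning {N}

  SameUnordered-reduce : ∀ {p q s t} → SameUnordered (liftedPair p s) (liftedPair q t) → SameUnordered p q
  SameUnordered-reduce {x , y} {x′ , y′} {s} {t} = Sum.map
    (Product.map (π-cong (π-lift x s) (π-lift x′ t)) (π-cong (π-lift y (2 * s)) (π-lift y′ (2 * t))))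
    (Product.map (π-cong (π-lift x s) (π-lift y′ (2 * t))) (π-cong (π-lift y (2 * s)) (π-lift x′ t)))
    where
    π-cong : ∀ {g h a b} → π g ≡ a → π h ≡ b → g ≡ h → a ≡ b
    π-cong πg≡a πh≡b refl = trans (sym πg≡a) πh≡b

  liftedPair-injective : Invertible u 3 → ∀ p {s t} → s < u → t < u →
                         SameUnordered (liftedPair p s) (liftedPair p t) → s ≡ t
  liftedPair-injective _ (x , _) s<u t<u (inj₁ (e , _)) = ≈⇒≡ s<u t<u (lift-injective x e)
  liftedPair-injective inv₃ (x , y) {s} {t} s<u t<u (inj₂ (e₁ , e₂)) =
    ≈⇒≡ s<u t<u (≈-trans s≈0 (≈-sym (≈-trans (≈-sym 2s≈t) (*-cong-≈ (≈-refl {a = 2}) s≈0))))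
    where
    x≡y : x ≡ y
    x≡y = trans (sym (π-lift x s)) (trans (cong π e₁) (π-lift y (2 * t)))
    s≈2t : s ≈[ u ] 2 * t
    s≈2t = lift-injective x (trans e₁ (cong (λ z → lift z (2 * t)) (sym x≡y)))
    2s≈t : 2 * s ≈[ u ] t
    2s≈t = lift-injective x (trans (cong (λ z → lift z (2 * s)) x≡y) e₂)
    3s≈0 : 3 * s ≈[ u ] 0
    3s≈0 = +-cancelʳ-≈ s (begin
      3 * s + s      ≡⟨ regroup s ⟩
      2 * (2 * s)    ≈⟨ *-cong-≈ (≈-refl {a = 2}) 2s≈t ⟩
      2 * t          ≈⟨ s≈2t ⟨
      s              ∎)
      where
      open ≈-Reasoning {u}
      regroup : ∀ s → 3 * s + s ≡ 2 * (2 * s)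
      regroup = solve-∀
    s≈0 : s ≈[ u ] 0
    s≈0 = invertible-*-≈0 {c = 3} inv₃ 3s≈0

  Distinct : ∀ {n} → List (Fin n × Fin n) → Set
  Distinct = AllPairs (λ p q → ¬ SameUnordered p q)

  fibre-distinct : Invertible u 3 → ∀ p → Distinct (fibre p)
  fibre-distinct inv₃ p = AllPairs.applyUpTo⁺₁ (liftedPair p) u
    (λ i<j j<u same → <⇒≢ i<j (liftedPair-injective inv₃ p (<-trans i<j j<u) j<u same))

  liftPairs-distinct : Invertible u 3 → ∀ {S} → Distinct S → Distinct (liftPairs S)
  liftPairs-distinct inv₃ {S} distinct = AllPairs.concat⁺
    (All.map⁺ (All.universal (fibre-distinct inv₃) S))
    (AllPairs.map⁺ (AllPairs.map (λ {p} {q} p≉q →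
      All.applyUpTo⁺₂ (liftedPair p) u λ s → All.applyUpTo⁺₂ (liftedPair q) u λ t →
        p≉q ∘ SameUnordered-reduce {s = s} {t = t}) distinct))

  ∈-blowUp⇔ : ∀ {A B} → IsBlowUp v u A B → ∀ g → g ∈ B ⇔ π g ∈ A
  ∈-blowUp⇔ {A} {B} blowUp g = mk⇔ to from
    where
    to : g ∈ B → π g ∈ A
    to g∈B with Equivalence.to (blowUp g) g∈B
    ... | a , a∈A , s , _ , a+vs≡g = subst (_∈ A) (toℕ-≈-injective (begin
      toℕ a           ≈⟨ +v*-≈ (toℕ a) s ⟨
      toℕ a + v * s   ≡⟨ a+vs≡g ⟩
      toℕ g           ≈⟨ toℕ-π g ⟨
      toℕ (π g)       ∎)) a∈A
      where open ≈-Reasoning {v}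
    from : π g ∈ A → g ∈ B
    from πg∈A = Equivalence.from (blowUp g) (π g , πg∈A , toℕ g / v , q<u , r+vq≡g)
      where
      q<u : toℕ g / v < u
      q<u = m<n*o⇒m/o<n (subst (toℕ g <_) (*-comm v u) (toℕ<n g))
      r+vq≡g : toℕ (π g) + v * (toℕ g / v) ≡ toℕ g
      r+vq≡g = trans (cong₂ _+_ (toℕ-fromℕ< (m%n<n (toℕ g) v)) (*-comm v (toℕ g / v)))
                     (sym (m≡m%n+[m/n]*n (toℕ g) v))

  ∣blowUp∣ : ∀ {A B} → IsBlowUp v u A B → ∣ B ∣ ≡ u * ∣ A ∣
  ∣blowUp∣ {A} {B} blowUp = begin
    ∣ B ∣              ≡⟨ cong ∣_∣ (lookup-ext {p = B} {cast u*v≡v*u R} lookup-B) ⟩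
    ∣ cast u*v≡v*u R ∣ ≡⟨ ∣cast∣ u*v≡v*u R ⟩
    ∣ R ∣              ≡⟨ ∣repeat∣ A u ⟩
    u * ∣ A ∣          ∎
    where
    open ≡-Reasoning
    u*v≡v*u = *-comm u v
    R = repeat A u
    lookup-B : ∀ g → lookup B g ≡ lookup (cast u*v≡v*u R) g
    lookup-B g = begin
      lookup B g                       ≡⟨ ∈⇔∈⇒lookup≡ (∈-blowUp⇔ blowUp g) ⟩
      lookup A (π g)                   ≡⟨ cong (λ i → lookup A (i mod v)) (toℕ-cast (sym u*v≡v*u) g) ⟨
      lookup A (toℕ g′ mod v)          ≡⟨ lookup-repeat A u g′ ⟨
      lookup R g′                      ≡⟨ Vec.lookup-cast₁ u*v≡v*u R g ⟨
      lookup (cast u*v≡v*u R) g        ∎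
      where g′ = Fin.cast (sym u*v≡v*u) g

  IsPPS-liftPairs : Invertible u 2 → Invertible u 3 → ∀ {A₁ A₂ B₁ B₂ S} →
                    IsBlowUp v u A₁ B₁ → IsBlowUp v u A₂ B₂ →
                    IsPPS v A₁ A₂ S → IsPPS N B₁ B₂ (liftPairs S)
  IsPPS-liftPairs inv₂ inv₃ {A₁} {A₂} {B₁} {B₂} {S} blowUp₁ blowUp₂ pps = record
    { sameSize = begin
        ∣ B₁ ∣     ≡⟨ ∣blowUp∣ blowUp₁ ⟩
        u * ∣ A₁ ∣ ≡⟨ cong (u *_) sameSize ⟩
        u * ∣ A₂ ∣ ≡⟨ ∣blowUp∣ blowUp₂ ⟨
        ∣ B₂ ∣     ∎
    ; distinct = liftPairs-distinct inv₃ distinct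
    ; count    = begin
        4 * length (liftPairs S) + ∣ B₁ ∣ ≡⟨ cong₂ (λ l b → 4 * l + b) (length-liftPairs S) (∣blowUp∣ blowUp₁) ⟩
        4 * (length S * u) + u * ∣ A₁ ∣   ≡⟨ regroup (length S) u ∣ A₁ ∣ ⟩
        (4 * length S + ∣ A₁ ∣) * u       ≡⟨ cong (_* u) count ⟩
        v * u                             ∎
    ; cover₁   = cover-liftPairs InPM InPM-reduce (InPM-lift inv₂) cover₁ (∈-blowUp⇔ blowUp₁)
    ; cover₂   = cover-liftPairs InPMDiffSum InPMDiffSum-reduce (InPMDiffSum-lift inv₃)
                                 cover₂ (∈-blowUp⇔ blowUp₂)
    }
    where
    open IsPPS pps
    open ≡-Reasoning
    regroup : ∀ l u a → 4 * (l * u) + u * a ≡ (4 * l + a) * u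
    regroup = solve-∀

mainTheorem15 : (u v : ℕ) → 0 < u → Coprime u 6 →
    (A₁ A₂ : Subset v) → PPS v A₁ A₂ →
    (B₁ B₂ : Subset (v * u)) → IsBlowUp v u A₁ B₁ → IsBlowUp v u A₂ B₂ →
    PPS (v * u) B₁ B₂
mainTheorem15 (suc u′) zero     _ _   [] [] pps      [] [] _       _       = pps
mainTheorem15 (suc u′) (suc v′) _ u⊥6 _  _  (S , pps) _  _  blowUp₁ blowUp₂ =
  liftPairs S , IsPPS-liftPairs inv₂ inv₃ blowUp₁ blowUp₂ pps
  where
  open BlowUp v′ u′
  inv₂ : Invertible u 2
  inv₂ = coprime⇒invertible {c = 2} (coprime-∣ʳ u⊥6 (divides 3 refl))
  inv₃ : Invertible u 3
  inv₃ = coprime⇒invertible {c = 3} (coprime-∣ʳ u⊥6 (divides 2 refl))
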